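{- Let $G_1$ and $G_2$ be two connected graphs with disjoint vertex sets, let $H=G_1+G_2$ be their join, and let $g$ be a constant function from the vertex set of one copy of $H$ to the vertex set of a disjoint copy of $H$. Then $fix(F_{H})=2fix(H)-i$ for some $i\in\{0,1\}$.
   Context: The join $G_1+G_2$ is the graph consisting of $G_1\cup G_2$ together with all edges joining every vertex of $G_1$ to every vertex of $G_2$. A set $S\subseteq V(X)$ is a fixing set of a graph $X$ if the only automorphism of $X$ fixing every vertex of $S$ is the identity; $fix(X)$ is the minimum cardinality of a fixing set of $X$. Functigraph: for a graph $H$, disjoint copies $H_1,H_2$ of $H$, $A=V(H_1)$, $B=V(H_2)$ and a function $g:A\to B$, $F_H$ is the graph with vertex set $A\cup B$ and edge set $E(H_1)\cup E(H_2)\cup\{uv:u\in A,\ v=g(u)\}$. -}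

module Defs where

open import Data.Nat using (ℕ; _+_)
open import Data.Bool using (Bool; true; false)
open import Data.Fin using (Fin; splitAt; _≟_)
open import Data.Fin.Subset using (Subset; _∈_; ∣_∣)
open import Data.Sum using (_⊎_; inj₁; inj₂)
open import Data.Product using (Σ; _×_; _,_)
open import Relation.Nullary using (¬_)
open import Relation.Nullary.Decidable using (⌊_⌋)
open import Relation.Binary.PropositionalEquality using (_≡_)

Graph : ℕ → Set
Graph n = Fin n → Fin n → Bool

IsSimple : ∀ {n} → Graph n → Set
IsSimple {n} G = (∀ u v → G u v ≡ G v u) × (∀ u → G u u ≡ false)

data Reach {n} (G : Graph n) : Fin n → Fin n → Set where
  here : ∀ {u} → Reach G u u
  step : ∀ {u v w} → G u v ≡ true → Reach G v w → Reach G u w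

Connected : ∀ {n} → Graph n → Set
Connected {n} G = Fin n × (∀ u v → Reach G u v)

record Automorphism {n} (G : Graph n) : Set where
  field
    σ     : Fin n → Fin n
    σ⁻¹   : Fin n → Fin n
    left  : ∀ v → σ⁻¹ (σ v) ≡ v
    right : ∀ v → σ (σ⁻¹ v) ≡ v
    pres  : ∀ u v → G (σ u) (σ v) ≡ G u v
open Automorphism public

IsFixingSet : ∀ {n} → Graph n → Subset n → Set
IsFixingSet {n} G S =
  (α : Automorphism G) → (∀ v → v ∈ S → σ α v ≡ v) → ∀ v → σ α v ≡ v

IsFixNumber : ∀ {n} → Graph n → ℕ → Set
IsFixNumber {n} G k =
  Σ (Subset n) (λ S → IsFixingSet G S × ∣ S ∣ ≡ k)
  × (∀ S → IsFixingSet G S → k Data.Nat.≤ ∣ S ∣)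

join : ∀ {n₁ n₂} → Graph n₁ → Graph n₂ → Graph (n₁ + n₂)
join {n₁} {n₂} G₁ G₂ x y with splitAt n₁ x | splitAt n₁ y
... | inj₁ u | inj₁ v = G₁ u v
... | inj₂ u | inj₂ v = G₂ u v
... | inj₁ _ | inj₂ _ = true
... | inj₂ _ | inj₁ _ = true

-- Functigraph F_H on Fin (n + n): first copy A = H₁, second copy B = H₂,
-- plus edges u g(u) for u ∈ A.
functigraph : ∀ {n} → Graph n → (Fin n → Fin n) → Graph (n + n)
functigraph {n} H g x y with splitAt n x | splitAt n y
... | inj₁ u | inj₁ v = H u v
... | inj₂ u | inj₂ v = H u v
... | inj₁ u | inj₂ v = ⌊ g u ≟ v ⌋
... | inj₂ u | inj₁ v = ⌊ g v ≟ u ⌋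

-- Write A and B for the two copies of H in F = F_H and b₂ ∈ B for the value of the
-- constant function. Pairs (α, β) of automorphisms of H with β b = b act on F copywise,
-- so a fixing set S₁ ∪ S₂ of F (S₁ ⊆ A, S₂ ⊆ B) yields the fixing sets S₁ and S₂ ∪ {b}
-- of H: 2 fix(H) ≤ fix(F) + 1. Conversely, b₂ is the only vertex of F of degree > |H|, so
-- every automorphism φ of F fixes it. A vertex of B other than b₂ has no neighbour in A;
-- as any two vertices of a join are at distance ≤ 2, if φ moved one vertex of A into B it
-- would move all of A injectively into B ∖ {b₂}, which is too small. So φ preserves both
-- copies, and T ∪ T is a fixing set of F for every fixing set T of H: fix(F) ≤ 2 fix(H).
module Submission where

open import Defs
open import Data.Nat using (ℕ; zero; suc; _+_; _*_; _≤_; _<_; z≤n; s≤s)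
open import Data.Nat.Properties hiding (_≟_)
open import Data.Bool using (Bool; true; false)
open import Data.Fin using (Fin; zero; suc; splitAt; _≟_; _↑ˡ_; _↑ʳ_; punchIn; punchOut)
  renaming (join to joinFin)
open import Data.Fin.Properties
  using (splitAt-↑ˡ; splitAt-↑ʳ; join-splitAt; ↑ˡ-injective; ↑ʳ-injective;
         punchInᵢ≢i; punchOut-injective; injective⇒≤)
open import Data.Fin.Subset using (Subset; _∈_; ∣_∣; ⁅_⁆; _∪_; inside; outside)
open import Data.Fin.Subset.Properties using (x∈⁅x⁆; p⊆p∪q; q⊆p∪q; ∣⁅x⁆∣≡1)
open import Data.Fin.Permutation using (permutation)
open import Data.Vec as Vec using ([]; _∷_; _++_)
open import Data.Vec.Properties using (lookup-++ˡ; lookup-++ʳ; []=⇒lookup; lookup⇒[]=)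
open import Data.Sum as Sum using (_⊎_; inj₁; inj₂)
open import Data.Empty using (⊥-elim)
open import Data.Product using (∃-syntax; _×_; _,_; proj₁; proj₂)
open import Function using (_∘_; id)
open import Function.Definitions using (Injective)
open import Relation.Nullary using (¬_; yes; no)
open import Relation.Nullary.Decidable using (⌊_⌋; isYes≗does; dec-true; dec-false)
open import Relation.Binary.PropositionalEquality
open import Algebra.Properties.CommutativeMonoid.Sum +-0-commutativeMonoid
  using (sum; sum-cong-≗; sum-permute; sum-remove)

↑ˡ⊎↑ʳ : ∀ {m k} (x : Fin (m + k)) → (∃[ i ] x ≡ i ↑ˡ k) ⊎ (∃[ j ] x ≡ m ↑ʳ j)
↑ˡ⊎↑ʳ {m} {k} x with splitAt m x | join-splitAt m k x
... | inj₁ i | eq = inj₁ (i , sym eq)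
... | inj₂ j | eq = inj₂ (j , sym eq)

↑ˡ≢↑ʳ : ∀ {m k} (i : Fin m) (j : Fin k) → i ↑ˡ k ≢ m ↑ʳ j
↑ˡ≢↑ʳ {m} {k} i j eq with trans (sym (splitAt-↑ˡ m i k)) (trans (cong (splitAt m) eq) (splitAt-↑ʳ m k j))
... | ()

⌊≟⌋-true : ∀ {m} {x y : Fin m} → x ≡ y → ⌊ x ≟ y ⌋ ≡ true
⌊≟⌋-true {x = x} {y} x≡y = trans (isYes≗does (x ≟ y)) (dec-true (x ≟ y) x≡y)

⌊≟⌋-false : ∀ {m} {x y : Fin m} → x ≢ y → ⌊ x ≟ y ⌋ ≡ false
⌊≟⌋-false {x = x} {y} x≢y = trans (isYes≗does (x ≟ y)) (dec-false (x ≟ y) x≢y)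

⌊≟⌋-injective : ∀ {m k} (f : Fin m → Fin k) → Injective _≡_ _≡_ f →
                ∀ x y → ⌊ f x ≟ f y ⌋ ≡ ⌊ x ≟ y ⌋
⌊≟⌋-injective f f-inj x y with x ≟ y
... | yes refl = ⌊≟⌋-true refl
... | no x≢y   = ⌊≟⌋-false (x≢y ∘ f-inj)

no-injection-avoiding : ∀ {n} (b : Fin n) (f : Fin n → Fin n) →
                        Injective _≡_ _≡_ f → ¬ (∀ i → f i ≢ b)
no-injection-avoiding {suc n} b f f-inj f≢b = 1+n≰n (injective⇒≤ punched-injective)
  where
  punched : Fin (suc n) → Fin n
  punched i = punchOut (f≢b i ∘ sym)

  punched-injective : Injective _≡_ _≡_ punched
  punched-injective eq = f-inj (punchOut-injective (f≢b _ ∘ sym) (f≢b _ ∘ sym) eq)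

k≤m≤k+1⇒k≡m⊎k+1≡m : ∀ {k m} → k ≤ m → m ≤ k + 1 → k ≡ m ⊎ k + 1 ≡ m
k≤m≤k+1⇒k≡m⊎k+1≡m {k} {m} k≤m m≤k+1 with m≤n⇒m<n∨m≡n k≤m
... | inj₂ k≡m = inj₁ k≡m
... | inj₁ k<m = inj₂ (≤-antisym (subst (_≤ m) (+-comm 1 k) k<m) m≤k+1)

sum-↑ : ∀ m k (f : Fin (m + k) → ℕ) → sum f ≡ sum (f ∘ (_↑ˡ k)) + sum (f ∘ (m ↑ʳ_))
sum-↑ zero    k f = refl
sum-↑ (suc m) k f = trans (cong (f zero +_) (sum-↑ m k (f ∘ suc))) (sym (+-assoc (f zero) _ _))

sum-mono-≤ : ∀ {m} {f g : Fin m → ℕ} → (∀ i → f i ≤ g i) → sum f ≤ sum g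
sum-mono-≤ {zero}  f≤g = z≤n
sum-mono-≤ {suc m} f≤g = +-mono-≤ (f≤g zero) (sum-mono-≤ (f≤g ∘ suc))

sum-const : ∀ m c → sum {m} (λ _ → c) ≡ m * c
sum-const zero    c = refl
sum-const (suc m) c = cong (c +_) (sum-const m c)

lookup≤sum : ∀ {m} (f : Fin m → ℕ) i → f i ≤ sum f
lookup≤sum {suc m} f i = ≤-trans (m≤m+n (f i) _) (≤-reflexive (sym (sum-remove {i = i} f)))

sum-supported : ∀ {m} (f : Fin m → ℕ) i → (∀ j → j ≢ i → f j ≡ 0) → sum f ≡ f i
sum-supported {suc m} f i vanishes = begin
  sum f                     ≡⟨ sum-remove {i = i} f ⟩
  f i + sum (f ∘ punchIn i) ≡⟨ cong (f i +_) zeros ⟩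
  f i + 0                   ≡⟨ +-identityʳ (f i) ⟩
  f i                       ∎
  where
  open ≡-Reasoning
  zeros : sum (f ∘ punchIn i) ≡ 0
  zeros = trans (sum-cong-≗ (λ j → vanishes (punchIn i j) (punchInᵢ≢i i j)))
                (trans (sum-const m 0) (*-zeroʳ m))

sum<length : ∀ {m} (f : Fin m → ℕ) i → (∀ j → f j ≤ 1) → f i ≡ 0 → sum f < m
sum<length {suc m} f i f≤1 fi≡0 = begin-strict
  sum f                     ≡⟨ sum-remove {i = i} f ⟩
  f i + sum (f ∘ punchIn i) ≡⟨ cong (_+ sum (f ∘ punchIn i)) fi≡0 ⟩
  sum (f ∘ punchIn i)       ≤⟨ sum-mono-≤ (f≤1 ∘ punchIn i) ⟩
  sum {m} (λ _ → 1)         ≡⟨ trans (sum-const m 1) (*-identityʳ m) ⟩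
  m                         <⟨ n<1+n m ⟩
  suc m                     ∎
  where open ≤-Reasoning

∈-++⁺ˡ : ∀ {m k} (p : Subset m) (q : Subset k) {i} → i ∈ p → i ↑ˡ k ∈ p ++ q
∈-++⁺ˡ p q {i} i∈p = lookup⇒[]= (i ↑ˡ _) (p ++ q) (trans (lookup-++ˡ p q i) ([]=⇒lookup i∈p))

∈-++⁻ˡ : ∀ {m k} (p : Subset m) (q : Subset k) {i} → i ↑ˡ k ∈ p ++ q → i ∈ p
∈-++⁻ˡ p q {i} i∈p++q = lookup⇒[]= i p (trans (sym (lookup-++ˡ p q i)) ([]=⇒lookup i∈p++q))

∈-++⁺ʳ : ∀ {m k} (p : Subset m) (q : Subset k) {j} → j ∈ q → m ↑ʳ j ∈ p ++ q
∈-++⁺ʳ p q {j} j∈q = lookup⇒[]= (_ ↑ʳ j) (p ++ q) (trans (lookup-++ʳ p q j) ([]=⇒lookup j∈q))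

∈-++⁻ʳ : ∀ {m k} (p : Subset m) (q : Subset k) {j} → m ↑ʳ j ∈ p ++ q → j ∈ q
∈-++⁻ʳ p q {j} j∈p++q = lookup⇒[]= j q (trans (sym (lookup-++ʳ p q j)) ([]=⇒lookup j∈p++q))

∣p++q∣≡∣p∣+∣q∣ : ∀ {m k} (p : Subset m) (q : Subset k) → ∣ p ++ q ∣ ≡ ∣ p ∣ + ∣ q ∣
∣p++q∣≡∣p∣+∣q∣ []            q = refl
∣p++q∣≡∣p∣+∣q∣ (inside  ∷ p) q = cong suc (∣p++q∣≡∣p∣+∣q∣ p q)
∣p++q∣≡∣p∣+∣q∣ (outside ∷ p) q = ∣p++q∣≡∣p∣+∣q∣ p q

∣p∪q∣≤∣p∣+∣q∣ : ∀ {m} (p q : Subset m) → ∣ p ∪ q ∣ ≤ ∣ p ∣ + ∣ q ∣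
∣p∪q∣≤∣p∣+∣q∣ []            []            = z≤n
∣p∪q∣≤∣p∣+∣q∣ (inside  ∷ p) (outside ∷ q) = s≤s (∣p∪q∣≤∣p∣+∣q∣ p q)
∣p∪q∣≤∣p∣+∣q∣ (inside  ∷ p) (inside  ∷ q) =
  s≤s (≤-trans (∣p∪q∣≤∣p∣+∣q∣ p q) (+-monoʳ-≤ ∣ p ∣ (n≤1+n ∣ q ∣)))
∣p∪q∣≤∣p∣+∣q∣ (outside ∷ p) (outside ∷ q) = ∣p∪q∣≤∣p∣+∣q∣ p q
∣p∪q∣≤∣p∣+∣q∣ (outside ∷ p) (inside  ∷ q) =
  ≤-trans (s≤s (∣p∪q∣≤∣p∣+∣q∣ p q)) (≤-reflexive (sym (+-suc ∣ p ∣ ∣ q ∣)))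

Loopless : ∀ {n} → Graph n → Set
Loopless {n} G = ∀ x → G x x ≡ false

WithinDistance2 : ∀ {n} → Graph n → Set
WithinDistance2 {n} G = ∀ x y → G x y ≡ true ⊎ (∃[ z ] G x z ≡ true × G z y ≡ true)

bit : Bool → ℕ
bit false = 0
bit true  = 1

bit≤1 : ∀ x → bit x ≤ 1
bit≤1 false = z≤n
bit≤1 true  = s≤s z≤n

degree : ∀ {n} → Graph n → Fin n → ℕ
degree G x = sum (bit ∘ G x)

degree<order : ∀ {n} (G : Graph n) → Loopless G → ∀ x → degree G x < n
degree<order G loopless x = sum<length (bit ∘ G x) x (bit≤1 ∘ G x) (cong bit (loopless x))

module _ {n} {G : Graph n} where

  σ-injective : (φ : Automorphism G) → Injective _≡_ _≡_ (σ φ)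
  σ-injective φ {x} {y} eq = trans (sym (left φ x)) (trans (cong (σ⁻¹ φ) eq) (left φ y))

  automorphism⁻¹ : Automorphism G → Automorphism G
  automorphism⁻¹ φ = record
    { σ = σ⁻¹ φ ; σ⁻¹ = σ φ ; left = right φ ; right = left φ
    ; pres = λ u v → trans (sym (pres φ (σ⁻¹ φ u) (σ⁻¹ φ v))) (cong₂ G (right φ u) (right φ v))
    }

  degree-invariant : (φ : Automorphism G) → ∀ x → degree G (σ φ x) ≡ degree G x
  degree-invariant φ x =
    trans (sum-permute (bit ∘ G (σ φ x)) (permutation (σ φ) (σ⁻¹ φ) (right φ) (left φ)))
          (sum-cong-≗ (cong bit ∘ pres φ x))

idAutomorphism : ∀ {n} (G : Graph n) → Automorphism G
idAutomorphism G = record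
  { σ = id ; σ⁻¹ = id ; left = λ _ → refl ; right = λ _ → refl ; pres = λ _ _ → refl }

module InducedCopy {N n} {G : Graph N} {H : Graph n} (ι : Fin n → Fin N)
                   (ι-injective : Injective _≡_ _≡_ ι) (ι-adj : ∀ i j → G (ι i) (ι j) ≡ H i j) where

  Invariant : Automorphism G → Set
  Invariant φ = ∀ i → ∃[ j ] σ φ (ι i) ≡ ι j

  restrict : (φ : Automorphism G) → Invariant φ → Invariant (automorphism⁻¹ φ) → Automorphism H
  restrict φ inv inv⁻¹ = record
    { σ = f ; σ⁻¹ = f⁻¹
    ; left  = λ v → ι-injective (trans (sym (ι-f⁻¹ (f v))) (trans (cong (σ⁻¹ φ) (sym (ι-f v))) (left φ (ι v))))
    ; right = λ v → ι-injective (trans (sym (ι-f (f⁻¹ v))) (trans (cong (σ φ) (sym (ι-f⁻¹ v))) (right φ (ι v))))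
    ; pres  = λ u v → trans (sym (ι-adj (f u) (f v)))
                      (trans (sym (cong₂ G (ι-f u) (ι-f v))) (trans (pres φ (ι u) (ι v)) (ι-adj u v)))
    }
    where
    f f⁻¹ : Fin n → Fin n
    f   = proj₁ ∘ inv
    f⁻¹ = proj₁ ∘ inv⁻¹
    ι-f : ∀ i → σ φ (ι i) ≡ ι (f i)
    ι-f = proj₂ ∘ inv
    ι-f⁻¹ : ∀ i → σ⁻¹ φ (ι i) ≡ ι (f⁻¹ i)
    ι-f⁻¹ = proj₂ ∘ inv⁻¹

  fixes-copy : (φ : Automorphism G) → Invariant φ → Invariant (automorphism⁻¹ φ) →
               ∀ {T} → IsFixingSet H T → (∀ t → t ∈ T → σ φ (ι t) ≡ ι t) → ∀ v → σ φ (ι v) ≡ ι v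
  fixes-copy φ inv inv⁻¹ T-fixing φ-fixes v =
    trans (proj₂ (inv v)) (cong ι (T-fixing (restrict φ inv inv⁻¹) fixes-T v))
    where
    fixes-T : ∀ t → t ∈ _ → proj₁ (inv t) ≡ t
    fixes-T t t∈T = ι-injective (trans (sym (proj₂ (inv t))) (φ-fixes t t∈T))

module Functigraph {n} (H : Graph n) (g : Fin n → Fin n) where

  F : Graph (n + n)
  F = functigraph H g

  ι₁ ι₂ : Fin n → Fin (n + n)
  ι₁ i = i ↑ˡ n
  ι₂ j = n ↑ʳ j

  adj₁₁ : ∀ i j → F (ι₁ i) (ι₁ j) ≡ H i j
  adj₁₁ i j rewrite splitAt-↑ˡ n i n | splitAt-↑ˡ n j n = refl

  adj₂₂ : ∀ i j → F (ι₂ i) (ι₂ j) ≡ H i j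
  adj₂₂ i j rewrite splitAt-↑ʳ n n i | splitAt-↑ʳ n n j = refl

  adj₁₂ : ∀ i j → F (ι₁ i) (ι₂ j) ≡ ⌊ g i ≟ j ⌋
  adj₁₂ i j rewrite splitAt-↑ˡ n i n | splitAt-↑ʳ n n j = refl

  adj₂₁ : ∀ i j → F (ι₂ j) (ι₁ i) ≡ ⌊ g i ≟ j ⌋
  adj₂₁ i j rewrite splitAt-↑ˡ n i n | splitAt-↑ʳ n n j = refl

  _⊕_ : (Fin n → Fin n) → (Fin n → Fin n) → Fin (n + n) → Fin (n + n)
  (α ⊕ β) x = joinFin n n (Sum.map α β (splitAt n x))

  ⊕-ι₁ : ∀ α β i → (α ⊕ β) (ι₁ i) ≡ ι₁ (α i)
  ⊕-ι₁ α β i rewrite splitAt-↑ˡ n i n = refl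

  ⊕-ι₂ : ∀ α β j → (α ⊕ β) (ι₂ j) ≡ ι₂ (β j)
  ⊕-ι₂ α β j rewrite splitAt-↑ʳ n n j = refl

  ⊕-inverse : ∀ {α α' β β'} → (∀ i → α' (α i) ≡ i) → (∀ j → β' (β j) ≡ j) →
              ∀ x → (α' ⊕ β') ((α ⊕ β) x) ≡ x
  ⊕-inverse {α} {α'} {β} {β'} α'α β'β x with ↑ˡ⊎↑ʳ {n} {n} x
  ... | inj₁ (i , refl) = trans (cong (α' ⊕ β') (⊕-ι₁ α β i)) (trans (⊕-ι₁ α' β' (α i)) (cong ι₁ (α'α i)))
  ... | inj₂ (j , refl) = trans (cong (α' ⊕ β') (⊕-ι₂ α β j)) (trans (⊕-ι₂ α' β' (β j)) (cong ι₂ (β'β j)))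

  ⊕-automorphism : (α β : Automorphism H) → (∀ i → g (σ α i) ≡ σ β (g i)) → Automorphism F
  ⊕-automorphism α β g-equivariant = record
    { σ = σ α ⊕ σ β ; σ⁻¹ = σ⁻¹ α ⊕ σ⁻¹ β
    ; left = ⊕-inverse (left α) (left β) ; right = ⊕-inverse (right α) (right β)
    ; pres = preserves
    }
    where
    cross : ∀ i j → ⌊ g (σ α i) ≟ σ β j ⌋ ≡ ⌊ g i ≟ j ⌋
    cross i j = trans (cong (λ y → ⌊ y ≟ σ β j ⌋) (g-equivariant i)) (⌊≟⌋-injective (σ β) (σ-injective β) (g i) j)

    preserves : ∀ u v → F ((σ α ⊕ σ β) u) ((σ α ⊕ σ β) v) ≡ F u v
    preserves u v with ↑ˡ⊎↑ʳ {n} {n} u | ↑ˡ⊎↑ʳ {n} {n} v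
    ... | inj₁ (i , refl) | inj₁ (j , refl) =
      trans (cong₂ F (⊕-ι₁ _ _ i) (⊕-ι₁ _ _ j)) (trans (adj₁₁ _ _) (trans (pres α i j) (sym (adj₁₁ i j))))
    ... | inj₂ (i , refl) | inj₂ (j , refl) =
      trans (cong₂ F (⊕-ι₂ _ _ i) (⊕-ι₂ _ _ j)) (trans (adj₂₂ _ _) (trans (pres β i j) (sym (adj₂₂ i j))))
    ... | inj₁ (i , refl) | inj₂ (j , refl) =
      trans (cong₂ F (⊕-ι₁ _ _ i) (⊕-ι₂ _ _ j)) (trans (adj₁₂ _ _) (trans (cross i j) (sym (adj₁₂ i j))))
    ... | inj₂ (j , refl) | inj₁ (i , refl) =
      trans (cong₂ F (⊕-ι₂ _ _ j) (⊕-ι₁ _ _ i)) (trans (adj₂₁ _ _) (trans (cross i j) (sym (adj₂₁ i j))))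

module ConstantFunctigraph {n} (H : Graph n) (b : Fin n) where

  open Functigraph H (λ _ → b) public

  module Copy₁ = InducedCopy {G = F} ι₁ (λ {i} {j} → ↑ˡ-injective n i j) adj₁₁
  module Copy₂ = InducedCopy {G = F} ι₂ (λ {i} {j} → ↑ʳ-injective n i j) adj₂₂

  b₂ : Fin (n + n)
  b₂ = ι₂ b

  fixingSet-restrictˡ : (S₁ S₂ : Subset n) → IsFixingSet F (S₁ ++ S₂) → IsFixingSet H S₁
  fixingSet-restrictˡ S₁ S₂ S-fixing α α-fixes v =
    ↑ˡ-injective n _ _ (trans (sym (⊕-ι₁ (σ α) id v)) (S-fixing φ φ-fixes (ι₁ v)))
    where
    φ : Automorphism F
    φ = ⊕-automorphism α (idAutomorphism H) (λ _ → refl)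
    φ-fixes : ∀ x → x ∈ S₁ ++ S₂ → σ φ x ≡ x
    φ-fixes x x∈S with ↑ˡ⊎↑ʳ {n} {n} x
    ... | inj₁ (i , refl) = trans (⊕-ι₁ (σ α) id i) (cong ι₁ (α-fixes i (∈-++⁻ˡ S₁ S₂ x∈S)))
    ... | inj₂ (j , refl) = ⊕-ι₂ (σ α) id j

  fixingSet-restrictʳ : (S₁ S₂ : Subset n) → IsFixingSet F (S₁ ++ S₂) → IsFixingSet H (⁅ b ⁆ ∪ S₂)
  fixingSet-restrictʳ S₁ S₂ S-fixing β β-fixes v =
    ↑ʳ-injective n _ _ (trans (sym (⊕-ι₂ id (σ β) v)) (S-fixing φ φ-fixes (ι₂ v)))
    where
    φ : Automorphism F
    φ = ⊕-automorphism (idAutomorphism H) β (λ _ → sym (β-fixes b (p⊆p∪q S₂ (x∈⁅x⁆ b))))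
    φ-fixes : ∀ x → x ∈ S₁ ++ S₂ → σ φ x ≡ x
    φ-fixes x x∈S with ↑ˡ⊎↑ʳ {n} {n} x
    ... | inj₁ (i , refl) = ⊕-ι₁ id (σ β) i
    ... | inj₂ (j , refl) =
      trans (⊕-ι₂ id (σ β) j) (cong ι₂ (β-fixes j (q⊆p∪q ⁅ b ⁆ S₂ (∈-++⁻ʳ S₁ S₂ x∈S))))

  fixNumber-lower : ∀ {h k} → IsFixNumber H h → IsFixNumber F k → h + h ≤ k + 1
  fixNumber-lower {h} {k} (_ , h-minimal) ((S , S-fixing , ∣S∣≡k) , _)
    with Vec.splitAt n S
  ... | S₁ , S₂ , refl = begin
    h + h                     ≤⟨ +-mono-≤ (h-minimal S₁ (fixingSet-restrictˡ S₁ S₂ S-fixing))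
                                          (h-minimal _ (fixingSet-restrictʳ S₁ S₂ S-fixing)) ⟩
    ∣ S₁ ∣ + ∣ ⁅ b ⁆ ∪ S₂ ∣   ≤⟨ +-monoʳ-≤ ∣ S₁ ∣ (∣p∪q∣≤∣p∣+∣q∣ ⁅ b ⁆ S₂) ⟩
    ∣ S₁ ∣ + (∣ ⁅ b ⁆ ∣ + ∣ S₂ ∣) ≡⟨ cong (λ c → ∣ S₁ ∣ + (c + ∣ S₂ ∣)) (∣⁅x⁆∣≡1 b) ⟩
    ∣ S₁ ∣ + suc ∣ S₂ ∣       ≡⟨ +-suc ∣ S₁ ∣ ∣ S₂ ∣ ⟩
    suc (∣ S₁ ∣ + ∣ S₂ ∣)     ≡⟨ cong suc (sym (∣p++q∣≡∣p∣+∣q∣ S₁ S₂)) ⟩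
    suc ∣ S₁ ++ S₂ ∣          ≡⟨ cong suc ∣S∣≡k ⟩
    suc k                     ≡⟨ +-comm 1 k ⟩
    k + 1                     ∎
    where open ≤-Reasoning

  module _ (loopless : Loopless H) (b-adjacent : ∃[ w ] H b w ≡ true) (close : WithinDistance2 H) where

    degree-b₂ : suc n ≤ degree F b₂
    degree-b₂ = begin
      suc n                                         ≡⟨ +-comm 1 n ⟩
      n + 1                                         ≤⟨ +-mono-≤ (≤-reflexive (sym from-A)) from-B ⟩
      sum (bit ∘ F b₂ ∘ ι₁) + sum (bit ∘ F b₂ ∘ ι₂) ≡⟨ sum-↑ n n (bit ∘ F b₂) ⟨
      degree F b₂                                   ∎
      where
      open ≤-Reasoning
      from-A : sum (bit ∘ F b₂ ∘ ι₁) ≡ n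
      from-A = trans (sum-cong-≗ (λ i → cong bit (trans (adj₂₁ i b) (⌊≟⌋-true refl))))
                     (trans (sum-const n 1) (*-identityʳ n))
      from-B : 1 ≤ sum (bit ∘ F b₂ ∘ ι₂)
      from-B = ≤-trans (≤-reflexive (cong bit (sym (trans (adj₂₂ b w) b~w))))
                       (lookup≤sum (bit ∘ F b₂ ∘ ι₂) w)
        where
        w = proj₁ b-adjacent
        b~w = proj₂ b-adjacent

    degree-≤ : ∀ x → x ≢ b₂ → degree F x ≤ n
    degree-≤ x x≢b₂ with ↑ˡ⊎↑ʳ {n} {n} x
    ... | inj₁ (i , refl) = begin
      degree F (ι₁ i)                                       ≡⟨ sum-↑ n n (bit ∘ F (ι₁ i)) ⟩
      sum (bit ∘ F (ι₁ i) ∘ ι₁) + sum (bit ∘ F (ι₁ i) ∘ ι₂) ≡⟨ cong₂ _+_ (sum-cong-≗ (cong bit ∘ adj₁₁ i)) to-B ⟩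
      degree H i + 1                                        ≡⟨ +-comm (degree H i) 1 ⟩
      suc (degree H i)                                      ≤⟨ degree<order H loopless i ⟩
      n                                                     ∎
      where
      open ≤-Reasoning
      to-B : sum (bit ∘ F (ι₁ i) ∘ ι₂) ≡ 1
      to-B = trans (sum-supported _ b (λ j j≢b → cong bit (trans (adj₁₂ i j) (⌊≟⌋-false (j≢b ∘ sym)))))
                   (cong bit (trans (adj₁₂ i b) (⌊≟⌋-true refl)))
    ... | inj₂ (c , refl) = begin
      degree F (ι₂ c)                                       ≡⟨ sum-↑ n n (bit ∘ F (ι₂ c)) ⟩
      sum (bit ∘ F (ι₂ c) ∘ ι₁) + sum (bit ∘ F (ι₂ c) ∘ ι₂) ≡⟨ cong₂ _+_ from-A (sum-cong-≗ (cong bit ∘ adj₂₂ c)) ⟩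
      degree H c                                            <⟨ degree<order H loopless c ⟩
      n                                                     ∎
      where
      open ≤-Reasoning
      from-A : sum (bit ∘ F (ι₂ c) ∘ ι₁) ≡ 0
      from-A = trans (sum-cong-≗ (λ i → cong bit (trans (adj₂₁ i c) (⌊≟⌋-false (x≢b₂ ∘ cong ι₂ ∘ sym)))))
                     (trans (sum-const n 0) (*-zeroʳ n))

    b₂-fixed : (φ : Automorphism F) → σ φ b₂ ≡ b₂
    b₂-fixed φ with σ φ b₂ ≟ b₂
    ... | yes fixed = fixed
    ... | no moved  = ⊥-elim (1+n≰n (begin
      suc n                 ≤⟨ degree-b₂ ⟩
      degree F b₂           ≡⟨ degree-invariant φ b₂ ⟨
      degree F (σ φ b₂)     ≤⟨ degree-≤ (σ φ b₂) moved ⟩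
      n                     ∎))
      where open ≤-Reasoning

    B-neighbours : ∀ c y → c ≢ b → F (ι₂ c) y ≡ true → ∃[ j ] y ≡ ι₂ j
    B-neighbours c y c≢b adjacent with ↑ˡ⊎↑ʳ {n} {n} y
    ... | inj₂ in-B = in-B
    ... | inj₁ (i , refl) with trans (sym adjacent) (trans (adj₂₁ i c) (⌊≟⌋-false (c≢b ∘ sym)))
    ...   | ()

    MovedToB : Automorphism F → Fin n → Set
    MovedToB φ a = ∃[ c ] σ φ (ι₁ a) ≡ ι₂ c

    moved-avoids-b : (φ : Automorphism F) → ∀ a c → σ φ (ι₁ a) ≡ ι₂ c → c ≢ b
    moved-avoids-b φ a c φa≡c refl = ↑ˡ≢↑ʳ a b (σ-injective φ (trans φa≡c (sym (b₂-fixed φ))))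

    moved-step : (φ : Automorphism F) → ∀ a a' → H a a' ≡ true → MovedToB φ a → MovedToB φ a'
    moved-step φ a a' adjacent (c , φa≡c) = B-neighbours c _ (moved-avoids-b φ a c φa≡c)
      (trans (cong (λ z → F z (σ φ (ι₁ a'))) (sym φa≡c))
             (trans (pres φ (ι₁ a) (ι₁ a')) (trans (adj₁₁ a a') adjacent)))

    moved-all : (φ : Automorphism F) → ∀ a → MovedToB φ a → ∀ a' → MovedToB φ a'
    moved-all φ a moved a' with close a a'
    ... | inj₁ adjacent            = moved-step φ a a' adjacent moved
    ... | inj₂ (z , a~z , z~a') = moved-step φ z a' z~a' (moved-step φ a z a~z moved)

    ι₁-invariant : (φ : Automorphism F) → Copy₁.Invariant φ
    ι₁-invariant φ a with ↑ˡ⊎↑ʳ {n} {n} (σ φ (ι₁ a))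
    ... | inj₁ in-A = in-A
    ... | inj₂ in-B = ⊥-elim (no-injection-avoiding b (proj₁ ∘ image) image-injective
                               (λ i → moved-avoids-b φ i _ (proj₂ (image i))))
      where
      image : ∀ a' → MovedToB φ a'
      image = moved-all φ a in-B
      image-injective : Injective _≡_ _≡_ (proj₁ ∘ image)
      image-injective {i} {j} eq = ↑ˡ-injective n i j
        (σ-injective φ (trans (proj₂ (image i)) (trans (cong ι₂ eq) (sym (proj₂ (image j))))))

    ι₂-invariant : (φ : Automorphism F) → Copy₂.Invariant φ
    ι₂-invariant φ j with ↑ˡ⊎↑ʳ {n} {n} (σ φ (ι₂ j))
    ... | inj₂ in-B = in-B
    ... | inj₁ (i , φj≡i) with ι₁-invariant (automorphism⁻¹ φ) i
    ...   | i' , φ⁻¹i≡i' = ⊥-elim (↑ˡ≢↑ʳ i' j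
            (trans (sym φ⁻¹i≡i') (trans (cong (σ⁻¹ φ) (sym φj≡i)) (left φ (ι₂ j)))))

    fixingSet-double : ∀ {T} → IsFixingSet H T → IsFixingSet F (T ++ T)
    fixingSet-double {T} T-fixing φ φ-fixes x with ↑ˡ⊎↑ʳ {n} {n} x
    ... | inj₁ (i , refl) =
      Copy₁.fixes-copy φ (ι₁-invariant φ) (ι₁-invariant (automorphism⁻¹ φ)) T-fixing
                       (λ t t∈T → φ-fixes (ι₁ t) (∈-++⁺ˡ T T t∈T)) i
    ... | inj₂ (j , refl) =
      Copy₂.fixes-copy φ (ι₂-invariant φ) (ι₂-invariant (automorphism⁻¹ φ)) T-fixing
                       (λ t t∈T → φ-fixes (ι₂ t) (∈-++⁺ʳ T T t∈T)) j

    fixNumber-upper : ∀ {h k} → IsFixNumber H h → IsFixNumber F k → k ≤ h + h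
    fixNumber-upper ((T , T-fixing , ∣T∣≡h) , _) (_ , k-minimal) =
      ≤-trans (k-minimal (T ++ T) (fixingSet-double T-fixing))
              (≤-reflexive (trans (∣p++q∣≡∣p∣+∣q∣ T T) (cong₂ _+_ ∣T∣≡h ∣T∣≡h)))

    fixNumber : ∀ {h k} → IsFixNumber H h → IsFixNumber F k → k ≡ h + h ⊎ k + 1 ≡ h + h
    fixNumber fixH fixF = k≤m≤k+1⇒k≡m⊎k+1≡m (fixNumber-upper fixH fixF) (fixNumber-lower fixH fixF)

module Join {n₁ n₂} (G₁ : Graph n₁) (G₂ : Graph n₂) where

  G : Graph (n₁ + n₂)
  G = join G₁ G₂

  adj₁₁ : ∀ i j → G (i ↑ˡ n₂) (j ↑ˡ n₂) ≡ G₁ i j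
  adj₁₁ i j rewrite splitAt-↑ˡ n₁ i n₂ | splitAt-↑ˡ n₁ j n₂ = refl

  adj₂₂ : ∀ i j → G (n₁ ↑ʳ i) (n₁ ↑ʳ j) ≡ G₂ i j
  adj₂₂ i j rewrite splitAt-↑ʳ n₁ n₂ i | splitAt-↑ʳ n₁ n₂ j = refl

  adj₁₂ : ∀ i j → G (i ↑ˡ n₂) (n₁ ↑ʳ j) ≡ true
  adj₁₂ i j rewrite splitAt-↑ˡ n₁ i n₂ | splitAt-↑ʳ n₁ n₂ j = refl

  adj₂₁ : ∀ i j → G (n₁ ↑ʳ j) (i ↑ˡ n₂) ≡ true
  adj₂₁ i j rewrite splitAt-↑ˡ n₁ i n₂ | splitAt-↑ʳ n₁ n₂ j = refl

  join-loopless : Loopless G₁ → Loopless G₂ → Loopless G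
  join-loopless loopless₁ loopless₂ x with ↑ˡ⊎↑ʳ {n₁} {n₂} x
  ... | inj₁ (i , refl) = trans (adj₁₁ i i) (loopless₁ i)
  ... | inj₂ (j , refl) = trans (adj₂₂ j j) (loopless₂ j)

  join-neighbour : Fin n₁ → Fin n₂ → ∀ x → ∃[ y ] G x y ≡ true
  join-neighbour v₁ v₂ x with ↑ˡ⊎↑ʳ {n₁} {n₂} x
  ... | inj₁ (i , refl) = n₁ ↑ʳ v₂ , adj₁₂ i v₂
  ... | inj₂ (j , refl) = v₁ ↑ˡ n₂ , adj₂₁ v₁ j

  join-withinDistance2 : Fin n₁ → Fin n₂ → WithinDistance2 G
  join-withinDistance2 v₁ v₂ x y with ↑ˡ⊎↑ʳ {n₁} {n₂} x | ↑ˡ⊎↑ʳ {n₁} {n₂} y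
  ... | inj₁ (i , refl) | inj₁ (j , refl) = inj₂ (n₁ ↑ʳ v₂ , adj₁₂ i v₂ , adj₂₁ j v₂)
  ... | inj₁ (i , refl) | inj₂ (j , refl) = inj₁ (adj₁₂ i j)
  ... | inj₂ (i , refl) | inj₁ (j , refl) = inj₁ (adj₂₁ j i)
  ... | inj₂ (i , refl) | inj₂ (j , refl) = inj₂ (v₁ ↑ˡ n₂ , adj₂₁ v₁ i , adj₁₂ v₁ j)

mainTheorem19 : ∀ {n₁ n₂} (G₁ : Graph n₁) (G₂ : Graph n₂) →
    IsSimple G₁ → IsSimple G₂ → Connected G₁ → Connected G₂ →
    (b : Fin (n₁ + n₂)) → (h k : ℕ) →
    IsFixNumber (join G₁ G₂) h →
    IsFixNumber (functigraph (join G₁ G₂) (λ _ → b)) k →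
    (k ≡ 2 * h) ⊎ (k + 1 ≡ 2 * h)
mainTheorem19 G₁ G₂ (_ , loopless₁) (_ , loopless₂) (v₁ , _) (v₂ , _) b h k fixH fixF =
  subst (λ m → k ≡ m ⊎ k + 1 ≡ m) (cong (h +_) (sym (+-identityʳ h)))
    (fixNumber (join-loopless loopless₁ loopless₂) (join-neighbour v₁ v₂ b) (join-withinDistance2 v₁ v₂)
               fixH fixF)
  where
  open Join G₁ G₂ using (join-loopless; join-neighbour; join-withinDistance2)
  open ConstantFunctigraph (join G₁ G₂) b using (fixNumber)
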